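{- For every integer $m\ge 1$, \[(F_{2m-2}+3F_{m-2}^2)(4F_{2m-2}+3F^2_{m-1})+F_{2m-2}F_{2m+2} = 3\left[F_{2m-2}(2F_{2m-3}+3F_{m+1}F_{m-2}+F_{m}F_{m-1})+F_mF_{m+1}F_{m-1}^2\right].\]
   Context: $F_p$ denotes the $p$th Fibonacci number ($F_0=0$, $F_1=1$, $F_{p+1}=F_p+F_{p-1}$), extended to negative indices by $F_{ -r}=(-1)^{r+1}F_r$. -}

module Defs where

open import Data.Nat using (ℕ; zero; suc)
open import Data.Integer using (ℤ; +_; -[1+_]; _+_; _*_; -_)

fibℕ : ℕ → ℤ
fibℕ zero = + 0
fibℕ (suc zero) = + 1
fibℕ (suc (suc n)) = fibℕ (suc n) + fibℕ n

sgn : ℕ → ℤ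
sgn zero = - (+ 1)
sgn (suc r) = - sgn r

-- Extension to integer indices: F_{-r} = (-1)^(r+1) F_r
F : ℤ → ℤ
F (+ n) = fibℕ n
F -[1+ n ] = sgn (suc n) * fibℕ (suc n)

module Submission where

-- For m = 1 both sides are closed integer expressions (they
-- involve F₋₁ = 1) and agree by evaluation.  For m = n + 2 every index is
-- non-negative, and the identity is a polynomial identity in a = Fₙ and
-- b = Fₙ₊₁:
--   * the single indices m-2, m-1, m, m+1 give Fₙ, Fₙ₊₁, Fₙ₊₂, Fₙ₊₃, which
--     are a, b, b+a, (b+a)+b by the Fibonacci recursion;
--   * the doubled indices 2m-3, 2m-2, 2m+2 equal 1+(n+n), 1+((n+1)+n) and
--     1+((n+3)+(n+2)), so the addition formula F_{p+q+1} = F_{p+1}F_{q+1} + F_pF_q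
--     expresses them through single-index values.

open import Defs
open import Data.Nat using (ℕ; zero; suc; _≥_)
import Data.Nat as ℕ
open import Data.Integer using (ℤ; +_; _+_; _-_; _*_)
open import Data.Integer.Tactic.RingSolver using (solve-∀)
open import Relation.Binary.PropositionalEquality using (_≡_; refl; sym; cong)

fib-add : ∀ p q → fibℕ (suc (p ℕ.+ q)) ≡ fibℕ (suc p) * fibℕ (suc q) + fibℕ p * fibℕ q
fib-add zero q = base (fibℕ (suc q)) (fibℕ q)
  where
  base : ∀ y x → y ≡ + 1 * y + + 0 * x
  base = solve-∀
fib-add (suc zero) q = base (fibℕ (suc q)) (fibℕ q)
  where
  base : ∀ y x → y + x ≡ + 1 * y + + 1 * x
  base = solve-∀
fib-add (suc (suc p)) q =
  step (fibℕ (suc (suc p))) (fibℕ (suc p)) (fibℕ p) (fibℕ (suc q)) (fibℕ q)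
       (fib-add (suc p) q) (fib-add p q)
  where
  -- F_{p+q+3} = F_{p+q+2} + F_{p+q+1}; add the two previous instances.
  step : ∀ u t v y x {s r} → s ≡ u * y + t * x → r ≡ t * y + v * x
       → s + r ≡ (u + t) * y + (t + v) * x
  step u t v y x refl refl = regroup u t v y x
    where
    regroup : ∀ u t v y x → (u * y + t * x) + (t * y + v * x) ≡ (u + t) * y + (t + v) * x
    regroup = solve-∀

-- The identity of the lemma, as a relation among the seven Fibonacci values
-- it involves: A = F_{2m-2}, B = F_{m-2}, C = F_{m-1}, D = F_{2m+2},
-- E = F_{2m-3}, G = F_{m+1}, H = F_m.
Identity : (A B C D E G H : ℤ) → Set
Identity A B C D E G H =
  (A + + 3 * (B * B)) * (+ 4 * A + + 3 * (C * C)) + A * D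
  ≡ + 3 * (A * (+ 2 * E + + 3 * G * B + H * C) + H * G * (C * C))

-- Identity only depends on the values of its arguments; used to rewrite the
-- arguments whose indices are not syntactically of the expected shape.
-- (B, C, H are explicit: products of integers do not determine their factors.)
Identity-cong : ∀ {A A′ D D′ E E′ G G′} B C H → A ≡ A′ → D ≡ D′ → E ≡ E′ → G ≡ G′
              → Identity A B C D E G H → Identity A′ B C D′ E′ G′ H
Identity-cong B C H refl refl refl refl holds = holds

-- The polynomial core: with a = Fₙ, b = Fₙ₊₁ one has Fₙ₊₂ = b+a,
-- Fₙ₊₃ = (b+a)+b, Fₙ₊₄ = ((b+a)+b)+(b+a), and the doubled-index values are
-- the addition-formula expressions in these.
polynomial-identity : ∀ a b →
  Identity ((b + a) * b + b * a) a b
           ((((b + a) + b) + (b + a)) * ((b + a) + b) + ((b + a) + b) * (b + a))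
           (b * b + a * a) ((b + a) + b) (b + a)
polynomial-identity = expanded
  where
  -- The same statement with Identity unfolded, in the form the solver reads.
  expanded : ∀ a b →
    (((b + a) * b + b * a) + + 3 * (a * a)) * (+ 4 * ((b + a) * b + b * a) + + 3 * (b * b))
      + ((b + a) * b + b * a)
        * ((((b + a) + b) + (b + a)) * ((b + a) + b) + ((b + a) + b) * (b + a))
    ≡ + 3 * (((b + a) * b + b * a)
               * (+ 2 * (b * b + a * a) + + 3 * ((b + a) + b) * a + (b + a) * b)
             + (b + a) * ((b + a) + b) * (b * b))
  expanded = solve-∀

identity-shifted : ∀ n →
  Identity (fibℕ (suc (suc n ℕ.+ n))) (fibℕ n) (fibℕ (suc n))
           (fibℕ (suc (3 ℕ.+ n ℕ.+ (2 ℕ.+ n)))) (fibℕ (suc (n ℕ.+ n)))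
           (fibℕ (3 ℕ.+ n)) (fibℕ (2 ℕ.+ n))
identity-shifted n =
  Identity-cong (fibℕ n) (fibℕ (suc n)) (fibℕ (2 ℕ.+ n))
                (sym (fib-add (suc n) n))
                (sym (fib-add (3 ℕ.+ n) (2 ℕ.+ n)))
                (sym (fib-add n n))
                refl
                (polynomial-identity (fibℕ n) (fibℕ (suc n)))

-- For M = 2 + x, the indices 2M-2, 2M+2, 2M-3, M+1 in the shape used above
-- (the indices M-2, M-1, M already compute to x, 1 + x, 2 + x).
index-2M-2 : ∀ x → + 2 * (+ 2 + x) - + 2 ≡ + 1 + ((+ 1 + x) + x)
index-2M-2 = solve-∀

index-2M+2 : ∀ x → + 2 * (+ 2 + x) + + 2 ≡ + 1 + ((+ 3 + x) + (+ 2 + x))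
index-2M+2 = solve-∀

index-2M-3 : ∀ x → + 2 * (+ 2 + x) - + 3 ≡ + 1 + (x + x)
index-2M-3 = solve-∀

index-M+1 : ∀ x → (+ 2 + x) + + 1 ≡ + 3 + x
index-M+1 = solve-∀

lemma4p3 : (m : ℕ) → m ≥ 1 →
    let M = + m in
    (F (+ 2 * M - + 2) + + 3 * (F (M - + 2) * F (M - + 2)))
      * (+ 4 * F (+ 2 * M - + 2) + + 3 * (F (M - + 1) * F (M - + 1)))
      + F (+ 2 * M - + 2) * F (+ 2 * M + + 2)
    ≡ + 3 * (F (+ 2 * M - + 2)
              * (+ 2 * F (+ 2 * M - + 3) + + 3 * F (M + + 1) * F (M - + 2) + F M * F (M - + 1))
            + F M * F (M + + 1) * (F (M - + 1) * F (M - + 1)))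
lemma4p3 (suc zero) _ = refl
lemma4p3 (suc (suc n)) _ =
  Identity-cong (fibℕ n) (fibℕ (suc n)) (fibℕ (2 ℕ.+ n))
                (sym (cong F (index-2M-2 (+ n))))
                (sym (cong F (index-2M+2 (+ n))))
                (sym (cong F (index-2M-3 (+ n))))
                (sym (cong F (index-M+1 (+ n))))
                (identity-shifted n)
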